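{- Suppose $H$ is a finite group containing a Hadamard difference set. Let $G$ be a finite group containing a normal subgroup $E_1\cong C_2$ and containing, as a subgroup of index $2$, a subgroup $L=H'E_1$ that is the internal direct product $H'\times E_1$ of $E_1$ with a subgroup $H'\cong H$. Then $G$ contains a Hadamard difference set.
   Context: For a finite group $G$ and $A=\sum a_g g\in\mathbb{Z}G$, $A^{(-1)}=\sum a_g g^{ -1}$. A Hadamard difference set in $G$ is a subset $D$ whose $\{\pm1\}$-valued characteristic function ($-1$ on $D$, $+1$ off $D$), viewed in $\mathbb{Z}G$, satisfies $DD^{(-1)}=|G|$. -}

module Defs where

open import Data.Nat using (ℕ) renaming (_*_ to _*ℕ_)
open import Data.Fin using (Fin; zero; suc; _≟_)
open import Data.Fin.Subset using (Subset; _∈_; ∣_∣)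
open import Data.Vec using (lookup)
open import Data.List using (List; foldr; map; allFin)
open import Data.Bool using (Bool; true; false; if_then_else_)
open import Data.Integer using (ℤ; +_; -[1+_]; _+_; _*_)
open import Data.Product using (Σ; ∃; ∃-syntax; _×_; _,_)
open import Function.Bundles using (_⇔_)
open import Relation.Nullary using (does)
open import Relation.Binary.PropositionalEquality using (_≡_; refl; isEquivalence; cong; cong₂)
open import Algebra.Core using (Op₁; Op₂)
open import Algebra.Structures using (IsGroup; IsMonoid; IsSemigroup; IsMagma)

-- A finite group of order n is represented with carrier
-- Fin n (every finite group is isomorphic to one of this form) and with
-- propositional equality, using the library's IsGroup structure.

record FiniteGroup : Set where
  field
    order   : ℕ
    _∙_     : Op₂ (Fin order)
    ε       : Fin order
    _⁻¹     : Op₁ (Fin order)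
    isGroup : IsGroup _≡_ _∙_ ε _⁻¹
  infixl 7 _∙_
  infix 8 _⁻¹

open FiniteGroup public

module _ (G : FiniteGroup) where
  private
    open FiniteGroup G using () renaming (_∙_ to _·_; _⁻¹ to inv)
    El = Fin (order G)

  ℤ[_] : Set
  ℤ[_] = El → ℤ

  ΣG : (El → ℤ) → ℤ
  ΣG f = foldr _+_ (+ 0) (map f (allFin (order G)))

  -- product in ℤG:  (Σ a_g g)(Σ b_h h) = Σ_k (Σ_g a_g b_{g⁻¹k}) k
  mulℤG : ℤ[_] → ℤ[_] → ℤ[_]
  mulℤG A B k = ΣG (λ g → A g * B (inv g · k))

  -- A^(-1) = Σ a_g g⁻¹, i.e. coefficient of g is a_{g⁻¹}
  invℤG : ℤ[_] → ℤ[_]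
  invℤG A g = A (inv g)

  scalarℤG : ℤ → ℤ[_]
  scalarℤG m g = if does (g ≟ ε G) then m else + 0

  χ : Subset (order G) → ℤ[_]
  χ D g = if lookup D g then -[1+ 0 ] else + 1

  -- Hadamard difference set: with D viewed as χ D,  D D^(-1) = |G|  in ℤG
  IsHadamardDifferenceSet : Subset (order G) → Set
  IsHadamardDifferenceSet D =
    ∀ g → mulℤG (χ D) (invℤG (χ D)) g ≡ scalarℤG (+ order G) g

  ContainsHadamardDifferenceSet : Set
  ContainsHadamardDifferenceSet = ∃[ D ] IsHadamardDifferenceSet D

  IsSubgroup : Subset (order G) → Set
  IsSubgroup S =
    (ε G ∈ S)
    × (∀ x y → x ∈ S → y ∈ S → (x · y) ∈ S)
    × (∀ x → x ∈ S → inv x ∈ S)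

  NormalizedBy : Subset (order G) → Subset (order G) → Set
  NormalizedBy N K = ∀ k x → k ∈ K → x ∈ N → ((k · x) · inv k) ∈ N

  IsNormalSubgroup : Subset (order G) → Set
  IsNormalSubgroup N = IsSubgroup N × (∀ g x → x ∈ N → ((g · x) · inv g) ∈ N)

  IsInternalDirectProduct : Subset (order G) → Subset (order G) → Subset (order G) → Set
  IsInternalDirectProduct L A B =
    IsSubgroup L × IsSubgroup A × IsSubgroup B
    × (∀ g → g ∈ L ⇔ (∃[ a ] ∃[ b ] (a ∈ A × b ∈ B × g ≡ a · b)))
    × (∀ g → g ∈ A → g ∈ B → g ≡ ε G)
    × NormalizedBy A L × NormalizedBy B L

  HasIndex : Subset (order G) → ℕ → Set
  HasIndex S i = i *ℕ ∣ S ∣ ≡ order G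

IsHomomorphism : (H G : FiniteGroup) → (Fin (order H) → Fin (order G)) → Set
IsHomomorphism H G φ = ∀ x y → φ (_∙_ H x y) ≡ _∙_ G (φ x) (φ y)

SubgroupIsoTo : (G : FiniteGroup) → Subset (order G) → FiniteGroup → Set
SubgroupIsoTo G S H =
  Σ (Fin (order H) → Fin (order G)) λ φ →
    IsHomomorphism H G φ
    × (∀ x y → φ x ≡ φ y → x ≡ y)
    × (∀ g → g ∈ S ⇔ (∃[ h ] φ h ≡ g))

xor2 : Op₂ (Fin 2)
xor2 zero y = y
xor2 (suc zero) zero = suc zero
xor2 (suc zero) (suc zero) = zero

private
  assoc2 : ∀ x y z → xor2 (xor2 x y) z ≡ xor2 x (xor2 y z)
  assoc2 zero y z = refl
  assoc2 (suc zero) zero z = refl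
  assoc2 (suc zero) (suc zero) zero = refl
  assoc2 (suc zero) (suc zero) (suc zero) = refl

  idr2 : ∀ x → xor2 x zero ≡ x
  idr2 zero = refl
  idr2 (suc zero) = refl

  inv2 : ∀ x → xor2 x x ≡ zero
  inv2 zero = refl
  inv2 (suc zero) = refl

C₂ : FiniteGroup
C₂ = record
  { order = 2
  ; _∙_ = xor2
  ; ε = zero
  ; _⁻¹ = λ x → x
  ; isGroup = record
    { isMonoid = record
      { isSemigroup = record
        { isMagma = record { isEquivalence = isEquivalence ; ∙-cong = cong₂ xor2 }
        ; assoc = assoc2 }
      ; identity = (λ x → refl) , idr2 }
    ; inverse = inv2 , inv2
    ; ⁻¹-cong = λ p → p }
  }

-- Transport the difference set of H along H ≅ H′ to a ±1-valued function d on H′, extended by 0;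
-- its autocorrelation is |H| times the delta at 1. Let e be the involution generating E₁ (central,
-- since E₁ is normal of order 2), pick t ∉ L, and put F x = Σᵢ sᵢ d (zᵢ x) with z = (1, e, t, et)
-- and s = (1, 1, 1, −1), i.e. F = (1 + e + t⁻¹ − t⁻¹e) d in ℤG. Since
-- (1 + e + t⁻¹ − t⁻¹e)(1 + e + t − et) = 4, the autocorrelation of F is 4|H| times the delta at 1.
-- The translates zᵢ⁻¹H′ are pairwise disjoint, so F takes values in {0, ±1}; as Σ F² = 4|H| while
-- |G| = 2|L| ≤ 4|H|, F never vanishes, and F is the ±1 characteristic function of a Hadamard
-- difference set in G.
module Submission where

open import Defs hiding (_∙_; ε; _⁻¹)
open import Level using (0ℓ)
open import Algebra.Bundles using (Group)
import Algebra.Properties.Group as GroupProperties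
open import Data.Bool using (true; false; if_then_else_)
open import Data.Empty using (⊥; ⊥-elim)
open import Data.Fin using (Fin; zero; suc; _≟_; combine; remQuot)
open import Data.Fin.Patterns using (0F; 1F; 2F; 3F)
open import Data.Fin.Permutation using (permutation)
open import Data.Fin.Properties using (¬∀⟶∃¬; remQuot-combine; suc-injective; 0≢1+n)
open import Data.Fin.Subset using (Subset; _∈_; _∉_; _⊆_; ∣_∣)
open import Data.Fin.Subset.Properties using (_∈?_; ⊆-antisym; ⊆⊤; ∣⊤∣≡n)
open import Data.Integer using (ℤ; +_; -1ℤ; _+_; _*_; -_; _-_; _≤_; +≤+)
open import Data.Integer.Properties
  using ( +-*-semiring; +-identityˡ; +-identityʳ; *-identityˡ; *-identityʳ; *-zeroˡ; *-zeroʳ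
        ; *-comm; +-mono-≤; +-monoʳ-≤; ≤-refl; ≤-trans; ≤-antisym; drop‿+≤+
        ; -1*i≡-i; i≤j⇒0≤j-i; i≤j⇒i-j≤0; i-j≡0⇒i≡j; pos-*; module ≤-Reasoning)
  renaming (_≟_ to _≟ℤ_)
open import Data.Integer.Tactic.RingSolver using (solve-∀)
import Data.List as List
open import Data.List.Properties using (map-tabulate)
open import Data.Nat as ℕ using (ℕ)
import Data.Nat.Properties as ℕ
open import Data.Product using (∃; ∃-syntax; _×_; _,_; proj₁; proj₂)
open import Data.Sum using (_⊎_; inj₁; inj₂)
open import Data.Vec using (lookup; tabulate; []; _∷_)
open import Data.Vec.Properties using (lookup∘tabulate; lookup⇒[]=)
open import Function using (_∘_; id)
open import Function.Bundles using (_⇔_; mk⇔; Equivalence)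
open import Relation.Nullary using (does; yes; no; ¬_; Dec)
open import Relation.Binary.PropositionalEquality
open import Algebra.Properties.Semiring.Sum +-*-semiring
  using ( sum; sum-syntax; sum-cong-≗; sum-replicate-zero; ∑-distrib-+; ∑-comm; ∑-permute
        ; *-distribˡ-sum; *-distribʳ-sum)

open Equivalence using (to; from)

sum-one : ∀ n → ∑[ i < n ] (+ 1) ≡ + n
sum-one ℕ.zero    = refl
sum-one (ℕ.suc n) = cong (_+_ (+ 1)) (sum-one n)

sum-neg : ∀ {n} (f : Fin n → ℤ) → ∑[ i < n ] (- f i) ≡ - sum f
sum-neg f = begin
  sum (λ i → - f i)      ≡⟨ sum-cong-≗ (λ i → sym (-1*i≡-i (f i))) ⟩
  sum (λ i → -1ℤ * f i)  ≡⟨ *-distribˡ-sum -1ℤ f ⟨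
  -1ℤ * sum f            ≡⟨ -1*i≡-i (sum f) ⟩
  - sum f                ∎
  where open ≡-Reasoning

sum-*-sum : ∀ {m n} (f : Fin m → ℤ) (g : Fin n → ℤ) →
            sum f * sum g ≡ ∑[ i < m ] ∑[ j < n ] (f i * g j)
sum-*-sum f g = trans (*-distribʳ-sum (sum g) f) (sum-cong-≗ (λ i → *-distribˡ-sum (f i) g))

sum-mono-≤ : ∀ {n} {f g : Fin n → ℤ} → (∀ i → f i ≤ g i) → sum f ≤ sum g
sum-mono-≤ {ℕ.zero}  _   = ≤-refl
sum-mono-≤ {ℕ.suc n} f≤g = +-mono-≤ (f≤g zero) (sum-mono-≤ (f≤g ∘ suc))

sum-nonNeg : ∀ {n} {f : Fin n → ℤ} → (∀ i → + 0 ≤ f i) → + 0 ≤ sum f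
sum-nonNeg {n} {f} 0≤f = subst (_≤ sum f) (sum-replicate-zero n) (sum-mono-≤ 0≤f)

term≤sum : ∀ {n} (f : Fin n → ℤ) → (∀ i → + 0 ≤ f i) → ∀ i → f i ≤ sum f
term≤sum f 0≤f zero    = subst (_≤ sum f) (+-identityʳ (f zero))
                           (+-monoʳ-≤ (f zero) (sum-nonNeg (0≤f ∘ suc)))
term≤sum f 0≤f (suc i) = subst (_≤ sum f) (+-identityˡ (f (suc i)))
                           (+-mono-≤ (0≤f zero) (term≤sum (f ∘ suc) (0≤f ∘ suc) i))

pointwise-≤∧sum-≥⇒≡ : ∀ {n} {f g : Fin n → ℤ} → (∀ i → f i ≤ g i) → sum g ≤ sum f → ∀ i → f i ≡ g i
pointwise-≤∧sum-≥⇒≡ {n} {f} {g} f≤g Σg≤Σf i = sym (i-j≡0⇒i≡j (g i) (f i) (≤-antisym gapᵢ≤0 (0≤gap i)))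
  where
  gap : Fin n → ℤ
  gap j = g j - f j

  0≤gap : ∀ j → + 0 ≤ gap j
  0≤gap j = i≤j⇒0≤j-i (f≤g j)

  sum-gap : sum gap ≡ sum g - sum f
  sum-gap = trans (∑-distrib-+ g (λ j → - f j)) (cong (_+_ (sum g)) (sum-neg f))

  gapᵢ≤0 : gap i ≤ + 0
  gapᵢ≤0 = ≤-trans (term≤sum gap 0≤gap i) (subst (_≤ + 0) (sym sum-gap) (i≤j⇒i-j≤0 Σg≤Σf))

foldr-tabulate : ∀ {n} (f : Fin n → ℤ) → List.foldr _+_ (+ 0) (List.tabulate f) ≡ sum f
foldr-tabulate {ℕ.zero}  f = refl
foldr-tabulate {ℕ.suc n} f = cong (_+_ (f zero)) (foldr-tabulate (f ∘ suc))

ΣG≡sum : ∀ G (f : Fin (order G) → ℤ) → ΣG G f ≡ sum f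
ΣG≡sum G f = trans (cong (List.foldr _+_ (+ 0)) (map-tabulate id f)) (foldr-tabulate f)

δ : ∀ {n} → Fin n → Fin n → ℤ
δ a b = if does (a ≟ b) then + 1 else + 0

δ-refl : ∀ {n} (a : Fin n) → δ a a ≡ + 1
δ-refl a with a ≟ a
... | yes _   = refl
... | no a≢a  = ⊥-elim (a≢a refl)

δ-≢ : ∀ {n} {a b : Fin n} → a ≢ b → δ a b ≡ + 0
δ-≢ {a = a} {b} a≢b with a ≟ b
... | yes a≡b = ⊥-elim (a≢b a≡b)
... | no _    = refl

δ-cong-⇔ : ∀ {m n} {a b : Fin m} {c d : Fin n} → (a ≡ b → c ≡ d) → (c ≡ d → a ≡ b) → δ a b ≡ δ c d
δ-cong-⇔ {a = a} {b} {c} {d} ⇒ ⇐ with a ≟ b | c ≟ d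
... | yes _   | yes _   = refl
... | no _    | no _    = refl
... | yes a≡b | no c≢d  = ⊥-elim (c≢d (⇒ a≡b))
... | no a≢b  | yes c≡d = ⊥-elim (a≢b (⇐ c≡d))

δ-nonNeg : ∀ {n} (a b : Fin n) → + 0 ≤ δ a b
δ-nonNeg a b with a ≟ b
... | yes _ = +≤+ ℕ.z≤n
... | no _  = +≤+ ℕ.z≤n

∑-δ* : ∀ {n} (a : Fin n) (f : Fin n → ℤ) → ∑[ i < n ] (δ a i * f i) ≡ f a
∑-δ* {ℕ.suc n} zero f = begin
  + 1 * f zero + ∑[ i < n ] (+ 0 * f (suc i))
    ≡⟨ cong₂ _+_ (*-identityˡ (f zero)) (sum-cong-≗ (λ i → *-zeroˡ (f (suc i)))) ⟩
  f zero + ∑[ i < n ] (+ 0)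
    ≡⟨ cong (_+_ (f zero)) (sum-replicate-zero n) ⟩
  f zero + + 0
    ≡⟨ +-identityʳ (f zero) ⟩
  f zero
    ∎
  where open ≡-Reasoning
∑-δ* {ℕ.suc n} (suc a) f = begin
  + 0 * f zero + ∑[ i < n ] (δ a i * f (suc i))  ≡⟨ cong₂ _+_ (*-zeroˡ (f zero)) (∑-δ* a (f ∘ suc)) ⟩
  + 0 + f (suc a)                                ≡⟨ +-identityˡ (f (suc a)) ⟩
  f (suc a)                                      ∎
  where open ≡-Reasoning

∑-δ : ∀ {n} (a : Fin n) → ∑[ i < n ] (δ a i) ≡ + 1
∑-δ a = trans (sum-cong-≗ (λ i → sym (*-identityʳ (δ a i)))) (∑-δ* a (λ _ → + 1))

-- Functions with values in {0, ±1}

IsSign : ℤ → Set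
IsSign x = x ≡ + 1 ⊎ x ≡ -1ℤ

IsTernary : ℤ → Set
IsTernary x = x ≡ + 0 ⊎ IsSign x

sign≢0 : ∀ {x} → IsSign x → x ≢ + 0
sign≢0 (inj₁ refl) ()
sign≢0 (inj₂ refl) ()

sign*ternary : ∀ {a b} → IsSign a → IsTernary b → IsTernary (a * b)
sign*ternary (inj₁ refl) (inj₁ refl)        = inj₁ refl
sign*ternary (inj₂ refl) (inj₁ refl)        = inj₁ refl
sign*ternary (inj₁ refl) (inj₂ (inj₁ refl)) = inj₂ (inj₁ refl)
sign*ternary (inj₁ refl) (inj₂ (inj₂ refl)) = inj₂ (inj₂ refl)
sign*ternary (inj₂ refl) (inj₂ (inj₁ refl)) = inj₂ (inj₂ refl)
sign*ternary (inj₂ refl) (inj₂ (inj₂ refl)) = inj₂ (inj₁ refl)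

ternary-square≤1 : ∀ {x} → IsTernary x → x * x ≤ + 1
ternary-square≤1 (inj₁ refl)        = +≤+ ℕ.z≤n
ternary-square≤1 (inj₂ (inj₁ refl)) = ≤-refl
ternary-square≤1 (inj₂ (inj₂ refl)) = ≤-refl

ternary-square≡1⇒sign : ∀ {x} → IsTernary x → x * x ≡ + 1 → IsSign x
ternary-square≡1⇒sign (inj₁ refl) ()
ternary-square≡1⇒sign (inj₂ sign) _ = sign

sum-ternary : ∀ {n} {f : Fin n → ℤ} → (∀ i → IsTernary (f i)) →
              (∀ i j → f i ≢ + 0 → f j ≢ + 0 → i ≡ j) → IsTernary (sum f)
sum-ternary {ℕ.zero}      _       _        = inj₁ refl
sum-ternary {ℕ.suc n} {f} ternary disjoint with ternary zero
... | inj₁ f₀≡0 = subst IsTernary (sym (trans (cong (_+ sum (f ∘ suc)) f₀≡0) (+-identityˡ _)))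
                    (sum-ternary (ternary ∘ suc) (λ i j p q → suc-injective (disjoint _ _ p q)))
... | inj₂ sign = subst IsTernary (sym (trans (cong (_+_ (f zero)) rest≡0) (+-identityʳ (f zero))))
                    (inj₂ sign)
  where
  vanishes : ∀ i → f (suc i) ≡ + 0
  vanishes i with f (suc i) ≟ℤ + 0
  ... | yes fᵢ≡0 = fᵢ≡0
  ... | no fᵢ≢0  = ⊥-elim (0≢1+n (disjoint zero (suc i) (sign≢0 sign) fᵢ≢0))

  rest≡0 : sum (f ∘ suc) ≡ + 0
  rest≡0 = trans (sum-cong-≗ vanishes) (sum-replicate-zero n)

χ-sign : ∀ G D g → IsSign (χ G D g)
χ-sign G D g with lookup D g
... | true  = inj₂ refl
... | false = inj₁ refl

sign-valued⇒χ : ∀ G (F : Fin (order G) → ℤ) → (∀ g → IsSign (F g)) → ∃ λ D → ∀ g → χ G D g ≡ F g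
sign-valued⇒χ G F sign = D , χD≗F
  where
  D : Subset (order G)
  D = tabulate (λ g → does (F g ≟ℤ -1ℤ))

  select : ∀ {x} → IsSign x → (if does (x ≟ℤ -1ℤ) then -1ℤ else + 1) ≡ x
  select (inj₁ refl) = refl
  select (inj₂ refl) = refl

  χD≗F : ∀ g → χ G D g ≡ F g
  χD≗F g = trans (cong (λ b → if b then -1ℤ else + 1) (lookup∘tabulate _ g)) (select (sign g))

indicator : ∀ {n} → Subset n → Fin n → ℤ
indicator p x = if lookup p x then + 1 else + 0

card≡sum-indicator : ∀ {n} (p : Subset n) → + ∣ p ∣ ≡ sum (indicator p)
card≡sum-indicator []          = refl
card≡sum-indicator (true ∷ p)  = cong (_+_ (+ 1)) (card≡sum-indicator p)
card≡sum-indicator (false ∷ p) = trans (card≡sum-indicator p) (sym (+-identityˡ _))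

card-≤-cover : ∀ {n k} (p : Subset n) (f : Fin k → Fin n) →
               (∀ x → x ∈ p → ∃ λ i → f i ≡ x) → ∣ p ∣ ℕ.≤ k
card-≤-cover {n} {k} p f covers = drop‿+≤+ (begin
  + ∣ p ∣                            ≡⟨ card≡sum-indicator p ⟩
  sum (indicator p)                  ≤⟨ sum-mono-≤ indicator≤preimages ⟩
  ∑[ x < n ] ∑[ i < k ] δ (f i) x    ≡⟨ ∑-comm (λ x i → δ (f i) x) ⟩
  ∑[ i < k ] ∑[ x < n ] δ (f i) x    ≡⟨ sum-cong-≗ (λ i → ∑-δ (f i)) ⟩
  ∑[ i < k ] (+ 1)                   ≡⟨ sum-one k ⟩
  + k                                ∎)
  where
  open ≤-Reasoning

  indicator≤preimages : ∀ x → indicator p x ≤ ∑[ i < k ] δ (f i) x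
  indicator≤preimages x with lookup p x in eq
  ... | false = sum-nonNeg (λ i → δ-nonNeg (f i) x)
  ... | true with covers x (lookup⇒[]= x p eq)
  ...   | i , refl = subst (_≤ ∑[ j < k ] δ (f j) (f i)) (δ-refl (f i))
                           (term≤sum (λ j → δ (f j) (f i)) (λ j → δ-nonNeg (f j) (f i)) i)

-- Correlations on a finite group

module GroupTheory (G : FiniteGroup) where

  group : Group 0ℓ 0ℓ
  group = record
    { Carrier = Fin (order G) ; _≈_ = _≡_ ; _∙_ = FiniteGroup._∙_ G
    ; ε = FiniteGroup.ε G ; _⁻¹ = FiniteGroup._⁻¹ G ; isGroup = isGroup G }

  open Group group public
    using (_∙_; ε; _⁻¹; assoc; identityˡ; identityʳ; inverseˡ; inverseʳ)
  open GroupProperties group public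
    using ( ε⁻¹≈ε; ⁻¹-involutive; ⁻¹-injective; ⁻¹-anti-homo-∙; inverseʳ-unique
          ; x∙y⁻¹≈ε⇒x≈y; x≈y⇒x∙y⁻¹≈ε; y≈x\\z; \\-leftDividesˡ; \\-leftDividesʳ
          ; //-rightDividesˡ; //-rightDividesʳ; ∙-cancelˡ)

  private
    n : ℕ
    n = order G

    El : Set
    El = Fin n

  sum-translate : ∀ a (f : El → ℤ) → ∑[ x < n ] f (a ∙ x) ≡ sum f
  sum-translate a f =
    sym (∑-permute f (permutation (a ∙_) (a ⁻¹ ∙_) (\\-leftDividesˡ a) (\\-leftDividesʳ a)))

  right-quotient-translate : ∀ a b x → (a ∙ x) ∙ (b ∙ x) ⁻¹ ≡ a ∙ b ⁻¹
  right-quotient-translate a b x = begin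
    (a ∙ x) ∙ (b ∙ x) ⁻¹     ≡⟨ cong ((a ∙ x) ∙_) (⁻¹-anti-homo-∙ b x) ⟩
    (a ∙ x) ∙ (x ⁻¹ ∙ b ⁻¹)  ≡⟨ assoc a x _ ⟩
    a ∙ (x ∙ (x ⁻¹ ∙ b ⁻¹))  ≡⟨ cong (a ∙_) (\\-leftDividesˡ x (b ⁻¹)) ⟩
    a ∙ b ⁻¹                 ∎
    where open ≡-Reasoning

  autocorrelation : (El → ℤ) → El → ℤ
  autocorrelation f k = ∑[ x < n ] (f (k ∙ x) * f x)

  HasFlatAutocorrelation : ℤ → (El → ℤ) → Set
  HasFlatAutocorrelation c f = ∀ k → autocorrelation f k ≡ c * δ k ε

  correlation-of-translates : ∀ f a b →
    ∑[ x < n ] (f (a ∙ x) * f (b ∙ x)) ≡ autocorrelation f (a ∙ b ⁻¹)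
  correlation-of-translates f a b = begin
    ∑[ x < n ] (f (a ∙ x) * f (b ∙ x))                          ≡⟨ sum-translate (b ⁻¹) _ ⟨
    ∑[ x < n ] (f (a ∙ (b ⁻¹ ∙ x)) * f (b ∙ (b ⁻¹ ∙ x)))        ≡⟨ sum-cong-≗ regroup ⟩
    autocorrelation f (a ∙ b ⁻¹)                                ∎
    where
    open ≡-Reasoning
    regroup : ∀ x → f (a ∙ (b ⁻¹ ∙ x)) * f (b ∙ (b ⁻¹ ∙ x)) ≡ f ((a ∙ b ⁻¹) ∙ x) * f x
    regroup x = cong₂ _*_ (cong f (sym (assoc a (b ⁻¹) x))) (cong f (\\-leftDividesˡ b x))

  δ-⁻¹ : ∀ k → δ (k ⁻¹) ε ≡ δ k ε
  δ-⁻¹ k = δ-cong-⇔ (λ k⁻¹≡ε → ⁻¹-injective (trans k⁻¹≡ε (sym ε⁻¹≈ε)))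
                    (λ k≡ε → trans (cong _⁻¹ k≡ε) ε⁻¹≈ε)

  scalarℤG≡*δ : ∀ c g → scalarℤG G c g ≡ c * δ g ε
  scalarℤG≡*δ c g with g ≟ ε
  ... | yes _ = sym (*-identityʳ c)
  ... | no _  = sym (*-zeroʳ c)

  mulℤG-invℤG : ∀ f k → mulℤG G f (invℤG G f) k ≡ autocorrelation f (k ⁻¹)
  mulℤG-invℤG f k = trans (ΣG≡sum G _) (sum-cong-≗ swap)
    where
    swap : ∀ g → f g * f ((g ⁻¹ ∙ k) ⁻¹) ≡ f (k ⁻¹ ∙ g) * f g
    swap g = trans (*-comm (f g) _)
      (cong (λ y → f y * f g) (trans (⁻¹-anti-homo-∙ (g ⁻¹) k) (cong (k ⁻¹ ∙_) (⁻¹-involutive g))))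

  hadamard⇔flat : ∀ D → IsHadamardDifferenceSet G D ⇔ HasFlatAutocorrelation (+ n) (χ G D)
  hadamard⇔flat D = mk⇔ hadamard⇒flat flat⇒hadamard
    where
    open ≡-Reasoning
    hadamard⇒flat : IsHadamardDifferenceSet G D → HasFlatAutocorrelation (+ n) (χ G D)
    hadamard⇒flat hadamard k = begin
      autocorrelation (χ G D) k              ≡⟨ cong (autocorrelation (χ G D)) (⁻¹-involutive k) ⟨
      autocorrelation (χ G D) (k ⁻¹ ⁻¹)      ≡⟨ mulℤG-invℤG (χ G D) (k ⁻¹) ⟨
      mulℤG G (χ G D) (invℤG G (χ G D)) (k ⁻¹) ≡⟨ hadamard (k ⁻¹) ⟩
      scalarℤG G (+ n) (k ⁻¹)                ≡⟨ scalarℤG≡*δ (+ n) (k ⁻¹) ⟩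
      + n * δ (k ⁻¹) ε                       ≡⟨ cong (+ n *_) (δ-⁻¹ k) ⟩
      + n * δ k ε                            ∎
    flat⇒hadamard : HasFlatAutocorrelation (+ n) (χ G D) → IsHadamardDifferenceSet G D
    flat⇒hadamard flat g = begin
      mulℤG G (χ G D) (invℤG G (χ G D)) g    ≡⟨ mulℤG-invℤG (χ G D) g ⟩
      autocorrelation (χ G D) (g ⁻¹)         ≡⟨ flat (g ⁻¹) ⟩
      + n * δ (g ⁻¹) ε                       ≡⟨ cong (+ n *_) (δ-⁻¹ g) ⟩
      + n * δ g ε                            ≡⟨ scalarℤG≡*δ (+ n) g ⟨
      scalarℤG G (+ n) g                     ∎

  combination : ∀ {r} → (Fin r → ℤ) → (Fin r → El) → (El → ℤ) → El → ℤ
  combination {r} s z f x = ∑[ i < r ] (s i * f (z i ∙ x))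

  δ-conjugate : ∀ a k b → δ ((a ∙ k) ∙ b ⁻¹) ε ≡ δ k (a ⁻¹ ∙ b)
  δ-conjugate a k b = δ-cong-⇔
    (λ q≡ε → y≈x\\z a k b (x∙y⁻¹≈ε⇒x≈y (a ∙ k) b q≡ε))
    (λ k≡a⁻¹b → x≈y⇒x∙y⁻¹≈ε (trans (cong (a ∙_) k≡a⁻¹b) (\\-leftDividesˡ a b)))

  autocorrelation-combination : ∀ {r} c (s : Fin r → ℤ) z f → HasFlatAutocorrelation c f → ∀ k →
    autocorrelation (combination s z f) k ≡ c * ∑[ i < r ] ∑[ j < r ] (s i * s j * δ k (z i ⁻¹ ∙ z j))
  autocorrelation-combination {r} c s z f flat k = begin
    ∑[ x < n ] (combination s z f (k ∙ x) * combination s z f x)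
      ≡⟨ sum-cong-≗ (λ x → sum-*-sum (λ i → s i * f (z i ∙ (k ∙ x))) (λ j → s j * f (z j ∙ x))) ⟩
    ∑[ x < n ] ∑[ i < r ] ∑[ j < r ] (s i * f (z i ∙ (k ∙ x)) * (s j * f (z j ∙ x)))
      ≡⟨ sum-cong-≗ (λ x → sum-cong-≗ (λ i → sum-cong-≗ (λ j → regroup x i j))) ⟩
    ∑[ x < n ] ∑[ i < r ] ∑[ j < r ] term i j x
      ≡⟨ ∑-comm (λ x i → ∑[ j < r ] term i j x) ⟩
    ∑[ i < r ] ∑[ x < n ] ∑[ j < r ] term i j x
      ≡⟨ sum-cong-≗ (λ i → ∑-comm (λ x j → term i j x)) ⟩
    ∑[ i < r ] ∑[ j < r ] ∑[ x < n ] term i j x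
      ≡⟨ sum-cong-≗ (λ i → sum-cong-≗ (λ j → pair i j)) ⟩
    ∑[ i < r ] ∑[ j < r ] (c * (s i * s j * δ k (z i ⁻¹ ∙ z j)))
      ≡⟨ sum-cong-≗ (λ i → *-distribˡ-sum c (λ j → s i * s j * δ k (z i ⁻¹ ∙ z j))) ⟨
    ∑[ i < r ] (c * ∑[ j < r ] (s i * s j * δ k (z i ⁻¹ ∙ z j)))
      ≡⟨ *-distribˡ-sum c (λ i → ∑[ j < r ] (s i * s j * δ k (z i ⁻¹ ∙ z j))) ⟨
    c * ∑[ i < r ] ∑[ j < r ] (s i * s j * δ k (z i ⁻¹ ∙ z j))
      ∎
    where
    open ≡-Reasoning
    term : Fin r → Fin r → El → ℤ
    term i j x = s i * s j * (f ((z i ∙ k) ∙ x) * f (z j ∙ x))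

    interchange : ∀ a b c d → a * b * (c * d) ≡ a * c * (b * d)
    interchange = solve-∀

    regroup : ∀ x i j → s i * f (z i ∙ (k ∙ x)) * (s j * f (z j ∙ x)) ≡ term i j x
    regroup x i j = trans (cong (λ y → s i * f y * (s j * f (z j ∙ x))) (sym (assoc (z i) k x)))
                          (interchange (s i) _ (s j) _)

    pull-out : ∀ a b d → a * (b * d) ≡ b * (a * d)
    pull-out = solve-∀

    pair : ∀ i j → ∑[ x < n ] term i j x ≡ c * (s i * s j * δ k (z i ⁻¹ ∙ z j))
    pair i j = begin
      ∑[ x < n ] term i j x
        ≡⟨ *-distribˡ-sum (s i * s j) (λ x → f ((z i ∙ k) ∙ x) * f (z j ∙ x)) ⟨
      s i * s j * ∑[ x < n ] (f ((z i ∙ k) ∙ x) * f (z j ∙ x))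
        ≡⟨ cong (s i * s j *_) (correlation-of-translates f _ _) ⟩
      s i * s j * autocorrelation f ((z i ∙ k) ∙ z j ⁻¹)
        ≡⟨ cong (s i * s j *_) (flat _) ⟩
      s i * s j * (c * δ ((z i ∙ k) ∙ z j ⁻¹) ε)
        ≡⟨ cong (λ d → s i * s j * (c * d)) (δ-conjugate (z i) k (z j)) ⟩
      s i * s j * (c * δ k (z i ⁻¹ ∙ z j))
        ≡⟨ pull-out (s i * s j) c _ ⟩
      c * (s i * s j * δ k (z i ⁻¹ ∙ z j))
        ∎

  flat-ternary⇒hadamard : ∀ c F → HasFlatAutocorrelation c F → (∀ x → IsTernary (F x)) →
                          + n ≤ c → ContainsHadamardDifferenceSet G
  flat-ternary⇒hadamard c F flat ternary n≤c = D , from (hadamard⇔flat D) χD-flat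
    where
    sum-squares : ∑[ x < n ] (F x * F x) ≡ c
    sum-squares = begin
      ∑[ x < n ] (F x * F x)  ≡⟨ sum-cong-≗ (λ x → cong (λ y → F y * F x) (identityˡ x)) ⟨
      autocorrelation F ε     ≡⟨ flat ε ⟩
      c * δ ε ε               ≡⟨ cong (c *_) (δ-refl ε) ⟩
      c * + 1                 ≡⟨ *-identityʳ c ⟩
      c                       ∎
      where open ≡-Reasoning

    squares≡1 : ∀ x → F x * F x ≡ + 1
    squares≡1 = pointwise-≤∧sum-≥⇒≡ (λ x → ternary-square≤1 (ternary x))
                        (subst₂ _≤_ (sym (sum-one n)) (sym sum-squares) n≤c)

    c≡n : c ≡ + n
    c≡n = trans (sym sum-squares) (trans (sum-cong-≗ squares≡1) (sum-one n))

    F-sign : ∀ x → IsSign (F x)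
    F-sign x = ternary-square≡1⇒sign (ternary x) (squares≡1 x)

    D : Subset n
    D = proj₁ (sign-valued⇒χ G F F-sign)

    χD≗F : ∀ x → χ G D x ≡ F x
    χD≗F = proj₂ (sign-valued⇒χ G F F-sign)

    χD-flat : HasFlatAutocorrelation (+ n) (χ G D)
    χD-flat k = trans (sum-cong-≗ (λ x → cong₂ _*_ (χD≗F (k ∙ x)) (χD≗F x)))
                      (trans (flat k) (cong (_* δ k ε) c≡n))

  IsProductOf : Subset n → Subset n → Subset n → Set
  IsProductOf L A B = ∀ g → g ∈ L ⇔ (∃[ a ] ∃[ b ] (a ∈ A × b ∈ B × g ≡ a ∙ b))

  product-⊇ˡ : ∀ {L A B} → IsProductOf L A B → ε ∈ B → A ⊆ L
  product-⊇ˡ L≡AB ε∈B {a} a∈A = from (L≡AB a) (a , ε , a∈A , ε∈B , sym (identityʳ a))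

  product-⊇ʳ : ∀ {L A B} → IsProductOf L A B → ε ∈ A → B ⊆ L
  product-⊇ʳ L≡AB ε∈A {b} b∈B = from (L≡AB b) (ε , b , ε∈A , b∈B , sym (identityˡ b))

  card-product-≤ : ∀ {a b} {L A B : Subset n} (φ : Fin a → El) (ψ : Fin b → El) →
    (∀ g → g ∈ A → ∃ λ h → φ h ≡ g) → (∀ g → g ∈ B → ∃ λ c → ψ c ≡ g) →
    IsProductOf L A B → ∣ L ∣ ℕ.≤ a ℕ.* b
  card-product-≤ {a} {b} {L} φ ψ A⊆φ B⊆ψ L≡AB = card-≤-cover L product covered
    where
    product : Fin (a ℕ.* b) → El
    product i = φ (proj₁ (remQuot {a} b i)) ∙ ψ (proj₂ (remQuot {a} b i))

    covered : ∀ g → g ∈ L → ∃ λ i → product i ≡ g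
    covered g g∈L with to (L≡AB g) g∈L
    ... | x , y , x∈A , y∈B , refl with A⊆φ x x∈A | B⊆ψ y y∈B
    ...   | h , refl | c , refl =
      combine h c , cong (λ (h , c) → φ h ∙ ψ c) (remQuot-combine {a} {b} h c)

  index-two-order-≤ : ∀ {L : Subset n} {k} → HasIndex G L 2 → ∣ L ∣ ℕ.≤ k → n ℕ.≤ 2 ℕ.* k
  index-two-order-≤ index ∣L∣≤k = subst (ℕ._≤ _) index (ℕ.*-monoʳ-≤ 2 ∣L∣≤k)

  index-two⇒∃∉ : ∀ (L : Subset n) → HasIndex G L 2 → ∃ λ t → t ∉ L
  index-two⇒∃∉ L index = ¬∀⟶∃¬ n (_∈ L) (_∈? L) L≢⊤
    where
    L≢⊤ : ¬ (∀ g → g ∈ L)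
    L≢⊤ all = Fin0-empty (subst Fin n≡0 ε)
      where
      Fin0-empty : Fin 0 → ⊥
      Fin0-empty ()
      ∣L∣≡n : ∣ L ∣ ≡ n
      ∣L∣≡n = trans (cong ∣_∣ (⊆-antisym ⊆⊤ (λ {x} _ → all x))) (∣⊤∣≡n n)
      n+n≡n : n ℕ.+ (n ℕ.+ 0) ≡ n ℕ.+ 0
      n+n≡n = trans (trans (cong (2 ℕ.*_) (sym ∣L∣≡n)) index) (sym (ℕ.+-identityʳ n))
      n≡0 : n ≡ 0
      n≡0 = ℕ.m+n≡0⇒m≡0 n (ℕ.+-cancelˡ-≡ n (n ℕ.+ 0) 0 n+n≡n)

  combination-ternary : ∀ {r} (s : Fin r → ℤ) z f (S : Subset n) → IsSubgroup G S →
    (∀ i → IsSign (s i)) → (∀ x → IsTernary (f x)) → (∀ x → f x ≢ + 0 → x ∈ S) →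
    (∀ i j → z j ∙ z i ⁻¹ ∈ S → i ≡ j) → ∀ x → IsTernary (combination s z f x)
  combination-ternary s z f S (_ , ∙-closed , ⁻¹-closed) s-sign f-ternary f-support separated x =
    sum-ternary (λ i → sign*ternary (s-sign i) (f-ternary (z i ∙ x))) terms-disjoint
    where
    support : ∀ i → s i * f (z i ∙ x) ≢ + 0 → z i ∙ x ∈ S
    support i nonzero = f-support _ (λ f≡0 → nonzero (trans (cong (s i *_) f≡0) (*-zeroʳ (s i))))

    terms-disjoint : ∀ i j → s i * f (z i ∙ x) ≢ + 0 → s j * f (z j ∙ x) ≢ + 0 → i ≡ j
    terms-disjoint i j nzᵢ nzⱼ = separated i j (subst (_∈ S) (right-quotient-translate (z j) (z i) x)
      (∙-closed _ _ (support j nzⱼ) (⁻¹-closed _ (support i nzᵢ))))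

-- Transport along an embedding

module Homomorphism (H G : FiniteGroup) (φ : Fin (order H) → Fin (order G))
                    (φ-hom : IsHomomorphism H G φ) where
  private module H = GroupTheory H
  open GroupTheory G

  φ-ε : φ H.ε ≡ ε
  φ-ε = ∙-cancelˡ (φ H.ε) (φ H.ε) ε
    (trans (sym (φ-hom H.ε H.ε)) (trans (cong φ (H.identityˡ H.ε)) (sym (identityʳ (φ H.ε)))))

  φ-⁻¹ : ∀ h → φ (h H.⁻¹) ≡ φ h ⁻¹
  φ-⁻¹ h = inverseʳ-unique (φ h) (φ (h H.⁻¹))
    (trans (sym (φ-hom h (h H.⁻¹))) (trans (cong φ (H.inverseʳ h)) φ-ε))

module Pushforward (H G : FiniteGroup) (φ : Fin (order H) → Fin (order G))
                   (φ-hom : IsHomomorphism H G φ) (φ-injective : ∀ x y → φ x ≡ φ y → x ≡ y)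
                   (S : Subset (order G)) (φ-image : ∀ g → g ∈ S ⇔ (∃[ h ] φ h ≡ g)) where
  private
    module H = GroupTheory H

    m n : ℕ
    m = order H
    n = order G
  open GroupTheory G
  open Homomorphism H G φ φ-hom

  pushforward : (Fin m → ℤ) → Fin n → ℤ
  pushforward d y = ∑[ h < m ] (δ (φ h) y * d h)

  pushforward-φ : ∀ d h₀ → pushforward d (φ h₀) ≡ d h₀
  pushforward-φ d h₀ = trans
    (sum-cong-≗ (λ h → cong (_* d h) (δ-cong-⇔ (sym ∘ φ-injective h h₀) (cong φ ∘ sym))))
    (∑-δ* h₀ d)

  pushforward-∉ : ∀ d y → y ∉ S → pushforward d y ≡ + 0
  pushforward-∉ d y y∉S = trans (sum-cong-≗ vanishes) (sum-replicate-zero m)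
    where
    vanishes : ∀ h → δ (φ h) y * d h ≡ + 0
    vanishes h = trans (cong (_* d h) (δ-≢ (λ φh≡y → y∉S (from (φ-image y) (h , φh≡y)))))
                       (*-zeroˡ (d h))

  pushforward-support : ∀ d y → pushforward d y ≢ + 0 → y ∈ S
  pushforward-support d y nonzero with y ∈? S
  ... | yes y∈S = y∈S
  ... | no y∉S  = ⊥-elim (nonzero (pushforward-∉ d y y∉S))

  pushforward-ternary : ∀ d → (∀ h → IsSign (d h)) → ∀ y → IsTernary (pushforward d y)
  pushforward-ternary d sign y with y ∈? S
  ... | no y∉S  = inj₁ (pushforward-∉ d y y∉S)
  ... | yes y∈S with to (φ-image y) y∈S
  ...   | h , refl = inj₂ (subst IsSign (sym (pushforward-φ d h)) (sign h))

  translate-∉ : ∀ k h → k ∉ S → k ∙ φ h ∉ S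
  translate-∉ k h k∉S kφh∈S with to (φ-image _) kφh∈S
  ... | h′ , φh′≡kφh = k∉S (from (φ-image k) (h′ H.∙ h H.⁻¹ , φ-quotient))
    where
    φ-quotient : φ (h′ H.∙ h H.⁻¹) ≡ k
    φ-quotient = begin
      φ (h′ H.∙ h H.⁻¹)      ≡⟨ φ-hom h′ (h H.⁻¹) ⟩
      φ h′ ∙ φ (h H.⁻¹)      ≡⟨ cong₂ _∙_ φh′≡kφh (φ-⁻¹ h) ⟩
      (k ∙ φ h) ∙ φ h ⁻¹     ≡⟨ assoc k (φ h) _ ⟩
      k ∙ (φ h ∙ φ h ⁻¹)     ≡⟨ cong (k ∙_) (inverseʳ (φ h)) ⟩
      k ∙ ε                  ≡⟨ identityʳ k ⟩
      k                      ∎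
      where open ≡-Reasoning

  pushforward-flat : ∀ c d → H.HasFlatAutocorrelation c d → HasFlatAutocorrelation c (pushforward d)
  pushforward-flat c d flat k = begin
    ∑[ x < n ] (d′ (k ∙ x) * d′ x)
      ≡⟨ sum-cong-≗ expand ⟩
    ∑[ x < n ] ∑[ h < m ] (δ (φ h) x * (d h * d′ (k ∙ x)))
      ≡⟨ ∑-comm (λ x h → δ (φ h) x * (d h * d′ (k ∙ x))) ⟩
    ∑[ h < m ] ∑[ x < n ] (δ (φ h) x * (d h * d′ (k ∙ x)))
      ≡⟨ sum-cong-≗ (λ h → ∑-δ* (φ h) (λ x → d h * d′ (k ∙ x))) ⟩
    ∑[ h < m ] (d h * d′ (k ∙ φ h))
      ≡⟨ translated k (k ∈? S) ⟩
    c * δ k ε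
      ∎
    where
    open ≡-Reasoning
    d′ : Fin n → ℤ
    d′ = pushforward d

    rearrange : ∀ a b e → a * (b * e) ≡ b * (e * a)
    rearrange = solve-∀

    expand : ∀ x → d′ (k ∙ x) * d′ x ≡ ∑[ h < m ] (δ (φ h) x * (d h * d′ (k ∙ x)))
    expand x = trans (*-distribˡ-sum (d′ (k ∙ x)) (λ h → δ (φ h) x * d h))
                     (sum-cong-≗ (λ h → rearrange (d′ (k ∙ x)) (δ (φ h) x) (d h)))

    φ-δ : ∀ k₀ → δ k₀ H.ε ≡ δ (φ k₀) ε
    φ-δ k₀ = δ-cong-⇔ (λ k₀≡ε → trans (cong φ k₀≡ε) φ-ε) (λ φk₀≡ε → φ-injective _ _ (trans φk₀≡ε (sym φ-ε)))

    translated : ∀ k → Dec (k ∈ S) → ∑[ h < m ] (d h * d′ (k ∙ φ h)) ≡ c * δ k ε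
    translated k (yes k∈S) with to (φ-image k) k∈S
    ... | k₀ , refl = begin
      ∑[ h < m ] (d h * d′ (φ k₀ ∙ φ h))  ≡⟨ sum-cong-≗ (λ h → trans (*-comm (d h) _) (cong (_* d h) (restrict h))) ⟩
      H.autocorrelation d k₀              ≡⟨ flat k₀ ⟩
      c * δ k₀ H.ε                        ≡⟨ cong (c *_) (φ-δ k₀) ⟩
      c * δ (φ k₀) ε                      ∎
      where
      restrict : ∀ h → d′ (φ k₀ ∙ φ h) ≡ d (k₀ H.∙ h)
      restrict h = trans (cong d′ (sym (φ-hom k₀ h))) (pushforward-φ d (k₀ H.∙ h))
    translated k (no k∉S) = begin
      ∑[ h < m ] (d h * d′ (k ∙ φ h))  ≡⟨ sum-cong-≗ vanishes ⟩
      ∑[ h < m ] (+ 0)                 ≡⟨ sum-replicate-zero m ⟩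
      + 0                              ≡⟨ *-zeroʳ c ⟨
      c * + 0                          ≡⟨ cong (c *_) (δ-≢ k≢ε) ⟨
      c * δ k ε                        ∎
      where
      vanishes : ∀ h → d h * d′ (k ∙ φ h) ≡ + 0
      vanishes h = trans (cong (d h *_) (pushforward-∉ d _ (translate-∉ k h k∉S))) (*-zeroʳ (d h))
      k≢ε : k ≢ ε
      k≢ε k≡ε = k∉S (from (φ-image k) (H.ε , trans φ-ε (sym k≡ε)))

-- The doubling construction

module CentralInvolution (G : FiniteGroup) (E : Subset (order G)) (E-normal : IsNormalSubgroup G E)
  (ψ : Fin 2 → Fin (order G)) (ψ-hom : IsHomomorphism C₂ G ψ)
  (ψ-injective : ∀ x y → ψ x ≡ ψ y → x ≡ y) (ψ-image : ∀ g → g ∈ E ⇔ (∃[ b ] ψ b ≡ g)) where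
  open GroupTheory G

  open Homomorphism C₂ G ψ ψ-hom using () renaming (φ-ε to ψ-ε)

  e : Fin (order G)
  e = ψ 1F

  ε∈E : ε ∈ E
  ε∈E = from (ψ-image ε) (0F , ψ-ε)

  e∈E : e ∈ E
  e∈E = from (ψ-image e) (1F , refl)

  e≢ε : e ≢ ε
  e≢ε e≡ε with ψ-injective 1F 0F (trans e≡ε (sym ψ-ε))
  ... | ()

  e∙e≡ε : e ∙ e ≡ ε
  e∙e≡ε = trans (sym (ψ-hom 1F 1F)) ψ-ε

  E-elements : ∀ x → x ∈ E → x ≡ ε ⊎ x ≡ e
  E-elements x x∈E with to (ψ-image x) x∈E
  ... | 0F , refl = inj₁ ψ-ε
  ... | 1F , refl = inj₂ refl

  e-central : ∀ g → g ∙ e ≡ e ∙ g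
  e-central g with E-elements _ (proj₂ E-normal g e e∈E)
  ... | inj₁ conj≡ε =
    ⊥-elim (e≢ε (∙-cancelˡ g e ε (trans (x∙y⁻¹≈ε⇒x≈y (g ∙ e) g conj≡ε) (sym (identityʳ g)))))
  ... | inj₂ conj≡e = trans (sym (//-rightDividesˡ g (g ∙ e))) (cong (_∙ g) conj≡e)

module SignedQuadruple (G : FiniteGroup) (e t : Fin (order G)) where
  open GroupTheory G

  z : Fin 4 → Fin (order G)
  z 0F = ε
  z 1F = e
  z 2F = t
  z 3F = e ∙ t

  s : Fin 4 → ℤ
  s 0F = + 1
  s 1F = + 1
  s 2F = + 1
  s 3F = -1ℤ

  s-sign : ∀ i → IsSign (s i)
  s-sign 0F = inj₁ refl
  s-sign 1F = inj₁ refl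
  s-sign 2F = inj₁ refl
  s-sign 3F = inj₂ refl

  quotient : Fin 4 → Fin 4 → Fin (order G)
  quotient 0F j  = z j
  quotient 1F 0F = e
  quotient 1F 1F = ε
  quotient 1F 2F = e ∙ t
  quotient 1F 3F = t
  quotient 2F 0F = t ⁻¹
  quotient 2F 1F = t ⁻¹ ∙ e
  quotient 2F 2F = ε
  quotient 2F 3F = e
  quotient 3F 0F = t ⁻¹ ∙ e
  quotient 3F 1F = t ⁻¹
  quotient 3F 2F = e
  quotient 3F 3F = ε

  module _ (e∙e≡ε : e ∙ e ≡ ε) (e-central : ∀ g → g ∙ e ≡ e ∙ g) where

    e⁻¹≡e : e ⁻¹ ≡ e
    e⁻¹≡e = sym (inverseʳ-unique e e e∙e≡ε)

    [e∙t]⁻¹≡t⁻¹∙e : (e ∙ t) ⁻¹ ≡ t ⁻¹ ∙ e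
    [e∙t]⁻¹≡t⁻¹∙e = trans (⁻¹-anti-homo-∙ e t) (cong (t ⁻¹ ∙_) e⁻¹≡e)

    t⁻¹∙e∙t≡e : t ⁻¹ ∙ (e ∙ t) ≡ e
    t⁻¹∙e∙t≡e = trans (cong (t ⁻¹ ∙_) (sym (e-central t))) (\\-leftDividesʳ t e)

    quotient-correct : ∀ i j → z i ⁻¹ ∙ z j ≡ quotient i j
    quotient-correct 0F j  = trans (cong (_∙ z j) ε⁻¹≈ε) (identityˡ (z j))
    quotient-correct 1F 0F = trans (identityʳ (e ⁻¹)) e⁻¹≡e
    quotient-correct 1F 1F = inverseˡ e
    quotient-correct 1F 2F = cong (_∙ t) e⁻¹≡e
    quotient-correct 1F 3F = \\-leftDividesʳ e t
    quotient-correct 2F 0F = identityʳ (t ⁻¹)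
    quotient-correct 2F 1F = refl
    quotient-correct 2F 2F = inverseˡ t
    quotient-correct 2F 3F = t⁻¹∙e∙t≡e
    quotient-correct 3F 0F = trans (identityʳ _) [e∙t]⁻¹≡t⁻¹∙e
    quotient-correct 3F 1F = begin
      (e ∙ t) ⁻¹ ∙ e    ≡⟨ cong (_∙ e) [e∙t]⁻¹≡t⁻¹∙e ⟩
      (t ⁻¹ ∙ e) ∙ e    ≡⟨ assoc (t ⁻¹) e e ⟩
      t ⁻¹ ∙ (e ∙ e)    ≡⟨ cong (t ⁻¹ ∙_) e∙e≡ε ⟩
      t ⁻¹ ∙ ε          ≡⟨ identityʳ (t ⁻¹) ⟩
      t ⁻¹              ∎
      where open ≡-Reasoning
    quotient-correct 3F 2F = trans (cong (_∙ t) [e∙t]⁻¹≡t⁻¹∙e) (trans (assoc (t ⁻¹) e t) t⁻¹∙e∙t≡e)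
    quotient-correct 3F 3F = inverseˡ (e ∙ t)

    signed-quotient-sum : ∀ k → ∑[ i < 4 ] ∑[ j < 4 ] (s i * s j * δ k (z i ⁻¹ ∙ z j)) ≡ + 4 * δ k ε
    signed-quotient-sum k = begin
      ∑[ i < 4 ] ∑[ j < 4 ] (s i * s j * δ k (z i ⁻¹ ∙ z j))
        ≡⟨ sum-cong-≗ (λ i → sum-cong-≗ (λ j → cong (λ q → s i * s j * δ k q) (quotient-correct i j))) ⟩
      ∑[ i < 4 ] ∑[ j < 4 ] (s i * s j * δ k (quotient i j))
        ≡⟨ cancellation (δ k ε) (δ k e) (δ k t) (δ k (t ⁻¹)) (δ k (e ∙ t)) (δ k (t ⁻¹ ∙ e)) ⟩
      + 4 * δ k ε
        ∎
      where
      open ≡-Reasoning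
      -- The double sum unfolded along the quotient table: only the diagonal terms δ k ε survive.
      cancellation : ∀ a b c d u v →
          (+ 1 * a + (+ 1 * b + (+ 1 * c + (-1ℤ * u + + 0))))
        + ((+ 1 * b + (+ 1 * a + (+ 1 * u + (-1ℤ * c + + 0))))
        + ((+ 1 * d + (+ 1 * v + (+ 1 * a + (-1ℤ * b + + 0))))
        + ((-1ℤ * v + (-1ℤ * d + (-1ℤ * b + (+ 1 * a + + 0)))) + + 0)))
        ≡ + 4 * a
      cancellation = solve-∀

    translates-disjoint : ∀ (S L : Subset (order G)) → IsSubgroup G L → S ⊆ L →
                          e ∈ L → e ∉ S → t ∉ L → ∀ i j → z j ∙ z i ⁻¹ ∈ S → i ≡ j
    translates-disjoint S L (ε∈L , ∙-closed , ⁻¹-closed) S⊆L e∈L e∉S t∉L = separated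
      where
      e∙t∉L : e ∙ t ∉ L
      e∙t∉L e∙t∈L = t∉L (subst (_∈ L) (\\-leftDividesʳ e t) (∙-closed _ _ (⁻¹-closed e e∈L) e∙t∈L))

      outside∙inside⁻¹∉ : ∀ {x y} → x ∈ L → y ∉ L → y ∙ x ⁻¹ ∉ L
      outside∙inside⁻¹∉ {x} {y} x∈L y∉L q∈L =
        y∉L (subst (_∈ L) (//-rightDividesˡ x y) (∙-closed _ _ q∈L x∈L))

      inside∙outside⁻¹∉ : ∀ {x y} → x ∈ L → y ∉ L → x ∙ y ⁻¹ ∉ L
      inside∙outside⁻¹∉ {x} {y} x∈L y∉L q∈L = outside∙inside⁻¹∉ x∈L y∉L (subst (_∈ L) inverse (⁻¹-closed _ q∈L))
        where
        inverse : (x ∙ y ⁻¹) ⁻¹ ≡ y ∙ x ⁻¹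
        inverse = trans (⁻¹-anti-homo-∙ x (y ⁻¹)) (cong (_∙ x ⁻¹) (⁻¹-involutive y))

      e∉S′ : ∀ {q} → q ≡ e → q ∉ S
      e∉S′ refl = e∉S

      separated : ∀ i j → z j ∙ z i ⁻¹ ∈ S → i ≡ j
      separated 0F 0F _ = refl
      separated 1F 1F _ = refl
      separated 2F 2F _ = refl
      separated 3F 3F _ = refl
      separated 0F 1F q = ⊥-elim (e∉S′ (trans (cong (e ∙_) ε⁻¹≈ε) (identityʳ e)) q)
      separated 1F 0F q = ⊥-elim (e∉S′ (trans (identityˡ (e ⁻¹)) e⁻¹≡e) q)
      separated 2F 3F q = ⊥-elim (e∉S′ (//-rightDividesʳ t e) q)
      separated 3F 2F q = ⊥-elim (e∉S′ (trans (cong (t ∙_) [e∙t]⁻¹≡t⁻¹∙e) (\\-leftDividesˡ t e)) q)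
      separated 0F 2F q = ⊥-elim (outside∙inside⁻¹∉ ε∈L t∉L   (S⊆L q))
      separated 0F 3F q = ⊥-elim (outside∙inside⁻¹∉ ε∈L e∙t∉L (S⊆L q))
      separated 1F 2F q = ⊥-elim (outside∙inside⁻¹∉ e∈L t∉L   (S⊆L q))
      separated 1F 3F q = ⊥-elim (outside∙inside⁻¹∉ e∈L e∙t∉L (S⊆L q))
      separated 2F 0F q = ⊥-elim (inside∙outside⁻¹∉ ε∈L t∉L   (S⊆L q))
      separated 2F 1F q = ⊥-elim (inside∙outside⁻¹∉ e∈L t∉L   (S⊆L q))
      separated 3F 0F q = ⊥-elim (inside∙outside⁻¹∉ ε∈L e∙t∉L (S⊆L q))
      separated 3F 1F q = ⊥-elim (inside∙outside⁻¹∉ e∈L e∙t∉L (S⊆L q))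

    signed-combination-flat : ∀ c f → HasFlatAutocorrelation c f →
                              HasFlatAutocorrelation (+ 4 * c) (combination s z f)
    signed-combination-flat c f flat k = begin
      autocorrelation (combination s z f) k
        ≡⟨ autocorrelation-combination c s z f flat k ⟩
      c * ∑[ i < 4 ] ∑[ j < 4 ] (s i * s j * δ k (z i ⁻¹ ∙ z j))
        ≡⟨ cong (c *_) (signed-quotient-sum k) ⟩
      c * (+ 4 * δ k ε)
        ≡⟨ reassociate c (+ 4) (δ k ε) ⟩
      + 4 * c * δ k ε
        ∎
      where
      open ≡-Reasoning
      reassociate : ∀ a b d → a * (b * d) ≡ b * a * d
      reassociate = solve-∀

corollary4p3 : (H G : FiniteGroup) → ContainsHadamardDifferenceSet H
    → (E₁ H′ L : Subset (order G))
    → IsNormalSubgroup G E₁ → SubgroupIsoTo G E₁ C₂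
    → IsSubgroup G H′ → SubgroupIsoTo G H′ H
    → IsSubgroup G L → HasIndex G L 2 → IsInternalDirectProduct G L H′ E₁
    → ContainsHadamardDifferenceSet G
corollary4p3 H G (D , D-hadamard) E₁ H′ L E₁-normal (ψ , ψ-hom , ψ-injective , ψ-image)
             H′-subgroup (φ , φ-hom , φ-injective , φ-image) L-subgroup L-index
             (_ , _ , _ , L≡H′E₁ , H′∩E₁≡ε , _ , _) =
  flat-ternary⇒hadamard (+ 4 * + m) F F-flat F-ternary order-≤
  where
  open GroupTheory G
  open CentralInvolution G E₁ E₁-normal ψ ψ-hom ψ-injective ψ-image
  open Pushforward H G φ φ-hom φ-injective H′ φ-image

  m : ℕ
  m = order H

  t : Fin (order G)
  t = proj₁ (index-two⇒∃∉ L L-index)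

  open SignedQuadruple G e t

  d : Fin m → ℤ
  d = χ H D

  F : Fin (order G) → ℤ
  F = combination s z (pushforward d)

  F-flat : HasFlatAutocorrelation (+ 4 * + m) F
  F-flat = signed-combination-flat e∙e≡ε e-central (+ m) (pushforward d)
             (pushforward-flat (+ m) d (to (GroupTheory.hadamard⇔flat H D) D-hadamard))

  F-ternary : ∀ x → IsTernary (F x)
  F-ternary = combination-ternary s z (pushforward d) H′ H′-subgroup s-sign
    (pushforward-ternary d (χ-sign H D)) (pushforward-support d)
    (translates-disjoint e∙e≡ε e-central H′ L L-subgroup (product-⊇ˡ L≡H′E₁ ε∈E)
       (product-⊇ʳ L≡H′E₁ (proj₁ H′-subgroup) e∈E) (λ e∈H′ → e≢ε (H′∩E₁≡ε e e∈H′ e∈E))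
       (proj₂ (index-two⇒∃∉ L L-index)))

  order-≤ : + order G ≤ + 4 * + m
  order-≤ = subst (+ order G ≤_) (trans (cong +_ 2[m*2]≡4m) (pos-* 4 m))
    (+≤+ (index-two-order-≤ {L} L-index
           (card-product-≤ φ ψ (λ g → to (φ-image g)) (λ g → to (ψ-image g)) L≡H′E₁)))
    where
    2[m*2]≡4m : 2 ℕ.* (m ℕ.* 2) ≡ 4 ℕ.* m
    2[m*2]≡4m = trans (cong (2 ℕ.*_) (ℕ.*-comm m 2)) (sym (ℕ.*-assoc 2 2 m))
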